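{- Let $n,m$ be integers with $1\le m\le n-2$ and let $G$ be a connected simple graph on $n$ vertices with vertex $2$-partiteness $v_2(G)\le m$. (1) If $n-m$ is even, then $H(G)\le\frac{3n^2-m^2+2mn-2m-2n}{8}$, with equality if and only if $G\cong K_m\vee\big(\overline{K_{(n-m)/2}}\vee\overline{K_{(n-m)/2}}\big)$. (2) If $n-m$ is odd, then $H(G)\le\frac{3n^2-m^2+2mn-2m-2n-1}{8}$, with equality if and only if $G\cong K_m\vee\big(\overline{K_{(n-m+1)/2}}\vee\overline{K_{(n-m-1)/2}}\big)$.
   Context: The vertex $2$-partiteness $v_2(G)$ is the minimum number of vertices whose deletion from $G$ yields a bipartite graph (parts possibly empty). The Harary index is $H(G)=\sum_{\{u,v\}\subseteq V(G)}\frac{1}{d(u,v)}$ over unordered pairs of distinct vertices, $d(u,v)$ the shortest-path distance. $G_1\vee G_2$ is the join; $\overline{K_r}$ is the edgeless graph on $r$ vertices; $K_m$ the complete graph. -}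

module Defs where

open import Data.Bool using (Bool; true; false; if_then_else_; _∧_; _∨_; not)
open import Data.Empty using (⊥-elim)
open import Relation.Nullary using (yes; no)
open import Data.Nat using (ℕ; zero; suc; _≤_; _<ᵇ_)
open import Data.Fin using (Fin; toℕ; splitAt; _≟_)
open import Data.Fin.Subset using (Subset; _∈_; _∉_; ∣_∣)
open import Data.List using (List; allFin; foldr; map)
open import Data.Bool.ListAction using (any)
open import Data.Integer using (ℤ; +_)
open import Data.Rational using (ℚ; 0ℚ; _+_; _/_)
open import Data.Sum using (inj₁; inj₂)
open import Data.Product using (Σ; ∃; ∃-syntax; _×_)
open import Relation.Nullary.Decidable using (⌊_⌋)
open import Relation.Binary.PropositionalEquality using (_≡_; _≢_; refl) renaming (sym to sym≡)
open import Function.Bundles using (_↔_; Inverse)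

record Graph (n : ℕ) : Set where
  field
    adj    : Fin n → Fin n → Bool
    sym    : ∀ u v → adj u v ≡ adj v u
    irrefl : ∀ u → adj u u ≡ false
open Graph public

reach : ∀ {n} → Graph n → ℕ → Fin n → Fin n → Bool
reach {n} G zero    u v = ⌊ u ≟ v ⌋
reach {n} G (suc k) u v = any (λ w → adj G u w ∧ reach G k w v) (allFin n)

Connected : ∀ {n} → Graph n → Set
Connected G = ∀ u v → ∃[ k ] (reach G k u v ≡ true)

minReach : ∀ {n} → Graph n → Fin n → Fin n → ℕ → ℕ → ℕ
minReach G u v zero     k = k
minReach G u v (suc f)  k = if reach G k u v then k else minReach G u v f (suc k)

-- shortest-path distance (searching k = 0 … n-1; in a connected graph on n
-- vertices the distance is always < n, so this is the true distance).
dist : ∀ {n} → Graph n → Fin n → Fin n → ℕ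
dist {n} G u v = minReach G u v n 0

recip : ℕ → ℚ
recip zero    = 0ℚ
recip (suc k) = (+ 1) / suc k

sumℚ : List ℚ → ℚ
sumℚ = foldr _+_ 0ℚ

harary : ∀ {n} → Graph n → ℚ
harary {n} G =
  sumℚ (map (λ u → sumℚ (map (λ v → if toℕ u <ᵇ toℕ v then recip (dist G u v) else 0ℚ)
                             (allFin n)))
            (allFin n))

BipartiteAfterDeleting : ∀ {n} → Graph n → Subset n → Set
BipartiteAfterDeleting {n} G S =
  Σ (Fin n → Bool) λ c → ∀ u v → u ∉ S → v ∉ S → adj G u v ≡ true → c u ≢ c v

-- v₂(G) ≤ m  (v₂ = minimum size of such a deleted set).
V2AtMost : ∀ {n} → Graph n → ℕ → Set
V2AtMost {n} G m = Σ (Subset n) λ S → (∣ S ∣ ≤ m) × BipartiteAfterDeleting G S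

_≅_ : ∀ {n k} → Graph n → Graph k → Set
_≅_ {n} {k} G H =
  Σ (Fin n ↔ Fin k) λ f → ∀ u v → adj G u v ≡ adj H (Inverse.to f u) (Inverse.to f v)

-- K_m ∨ (complement K_a ∨ complement K_b) on Fin (m + (a + b)):
-- part 0 = first m vertices (clique), part 1 = next a, part 2 = last b.
part : ∀ m a b → Fin (m Data.Nat.+ (a Data.Nat.+ b)) → ℕ
part m a b i with splitAt m i
... | inj₁ _ = 0
... | inj₂ j with splitAt a j
...   | inj₁ _ = 1
...   | inj₂ _ = 2

classAdj : ℕ → ℕ → Bool
classAdj x y = not ⌊ x Data.Nat.≟ y ⌋ ∨ ⌊ x Data.Nat.≟ 0 ⌋

classAdj-sym : ∀ x y → classAdj x y ≡ classAdj y x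
classAdj-sym x y with x Data.Nat.≟ y | y Data.Nat.≟ x
... | yes refl | yes _ = refl
... | yes refl | no q = ⊥-elim (q refl)
... | no p | yes q = ⊥-elim (p (sym≡ q))
... | no _ | no _ = refl

joinAdj : ∀ m a b → Fin (m Data.Nat.+ (a Data.Nat.+ b)) → Fin (m Data.Nat.+ (a Data.Nat.+ b)) → Bool
joinAdj m a b u v = not ⌊ u ≟ v ⌋ ∧ classAdj (part m a b u) (part m a b v)

joinAdj-sym : ∀ m a b u v → joinAdj m a b u v ≡ joinAdj m a b v u
joinAdj-sym m a b u v with u ≟ v | v ≟ u
... | yes refl | yes _ = refl
... | yes refl | no q = ⊥-elim (q refl)
... | no p | yes q = ⊥-elim (p (sym≡ q))
... | no _ | no _ = classAdj-sym (part m a b u) (part m a b v)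

joinAdj-irrefl : ∀ m a b u → joinAdj m a b u u ≡ false
joinAdj-irrefl m a b u with u ≟ u
... | yes _ = refl
... | no p = ⊥-elim (p refl)

KmJoinKab : ∀ m a b → Graph (m Data.Nat.+ (a Data.Nat.+ b))
KmJoinKab m a b = record
  { adj = joinAdj m a b ; sym = joinAdj-sym m a b ; irrefl = joinAdj-irrefl m a b }

module Submission where

-- If v₂(G) ≤ m, deleting a set S with |S| ≤ m leaves a bipartite graph;
-- labelling S by 0 and the colour classes by 1 and 2 gives a *cover*: G is
-- a subgraph of the join K_s ∨ (K̄_{c₁} ∨ K̄_{c₂}) of the classes, s ≤ m.
-- (1) Since 1/d(u,v) is 1 on an edge and at most 1/2 elsewhere,
--     H(G) ≤ W(G)/4 for the integer weight W(G) with W(G) + n = n² + 2|E|,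
--     and H(G) = W(G)/4 when non-adjacent vertices have common neighbours.
-- (2) Counting the edges of the join in terms of the class sizes turns
--     |E(G)| ≤ |E(join)| into 3n² + 2mn - (m² + 2m + 2n) = 2W(G) + slack
--     with an explicit nonnegative slack.
-- (3) The extremal graph K_m ∨ (K̄_{b+p} ∨ K̄_b), p the parity of n - m,
--     is its own cover with slack p ≤ 1.  Comparing gives W(G) ≤ W(extremal),
--     and equality forces slack = p, which makes G that graph.  Conversely
--     a graph isomorphic to it has the same weight and a universal vertex.

open import Defs hiding (sym)
open import Data.Bool using (Bool; true; false; if_then_else_; _∧_; not; T)
import Data.Bool.Properties as BoolP
open import Data.Nat using (ℕ; zero; suc; _+_; _*_; _∸_; _≤_; _<_; _<ᵇ_; _%_; _/_; z≤n; s≤s)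
import Data.Nat as ℕ
import Data.Nat.Properties as ℕP
open import Data.Nat.Tactic.RingSolver using (solve-∀)
open import Data.Integer as ℤ using (ℤ) renaming (_-_ to _-ℤ_)
import Data.Integer.Properties as ℤP
import Data.Integer.Tactic.RingSolver as ℤSolver
open import Data.Rational using (ℚ; 0ℚ; fromℚᵘ; toℚᵘ) renaming (_/_ to _/ℚ_; _≤_ to _≤ℚ_; _+_ to _+ℚ_)
import Data.Rational.Properties as ℚP
open import Data.Rational.Unnormalised as ℚᵘ using (mkℚᵘ; *≡*; *≤*)
import Data.Rational.Unnormalised.Properties as ℚᵘP
open import Data.Fin using (Fin; toℕ; _≟_; splitAt; join; _↑ˡ_; _↑ʳ_) renaming (zero to fz; suc to fs)
import Data.Fin.Properties as FinP
open import Data.List using (tabulate)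
import Data.List.Properties as ListP
open import Data.Bool.ListAction using (any)
open import Data.Product using (Σ; ∃; _×_; _,_; proj₁; proj₂)
open import Data.Empty using (⊥; ⊥-elim)
open import Relation.Nullary using (yes; no)
open import Relation.Nullary.Decidable using (⌊_⌋)
open import Relation.Binary using (tri<; tri≈; tri>)
open import Relation.Binary.PropositionalEquality
open import Function using (_∘_; id)
open import Function.Bundles using (_↔_; _⇔_; mk↔ₛ′; mk⇔; Inverse)
open import Algebra.Properties.Semiring.Sum ℕP.+-*-semiring
  using (sum; ∑-comm; ∑-distrib-+; sum-cong-≗; sum-permute; *-distribˡ-sum)
open import Data.Nat.DivMod using (m≡m%n+[m/n]*n; m*n/n≡m)
open import Data.Sum using (_⊎_; inj₁; inj₂)
import Data.Sum as Sum
open import Data.Fin.Subset using (Subset; _∉_; ∣_∣)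
open import Data.Vec using ([]; _∷_; lookup)
import Data.Vec.Properties as VecP
open import Function.Construct.Composition using (_↔-∘_)
open import Function.Properties.Inverse using (↔-sym)

𝟙 : Bool → ℕ
𝟙 true  = 1
𝟙 false = 0

𝟙-injective : ∀ {a b} → 𝟙 a ≡ 𝟙 b → a ≡ b
𝟙-injective {true}  {true}  _ = refl
𝟙-injective {false} {false} _ = refl

≟-refl : ∀ {n} (u : Fin n) → ⌊ u ≟ u ⌋ ≡ true
≟-refl u with u ≟ u
... | yes _  = refl
... | no u≢u = ⊥-elim (u≢u refl)

≟-≢ : ∀ {n} {u v : Fin n} → u ≢ v → ⌊ u ≟ v ⌋ ≡ false
≟-≢ {u = u} {v} u≢v with u ≟ v
... | yes u≡v = ⊥-elim (u≢v u≡v)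
... | no _    = refl

≟-≡ : ∀ {n} {u v : Fin n} → ⌊ u ≟ v ⌋ ≡ true → u ≡ v
≟-≡ {u = u} {v} _ with u ≟ v
... | yes u≡v = u≡v

_≠_ : ∀ {n} → Fin n → Fin n → Bool
u ≠ v = not ⌊ u ≟ v ⌋

≠-irrefl : ∀ {n} (u : Fin n) → (u ≠ u) ≡ false
≠-irrefl u rewrite ≟-refl u = refl

≠-sym : ∀ {n} (u v : Fin n) → (u ≠ v) ≡ (v ≠ u)
≠-sym u v with u ≟ v | v ≟ u
... | yes refl | yes _   = refl
... | yes refl | no v≢u  = ⊥-elim (v≢u refl)
... | no u≢v   | yes v≡u = ⊥-elim (u≢v (sym v≡u))
... | no _     | no _    = refl

sum-const : ∀ {n} c → sum {n} (λ _ → c) ≡ n * c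
sum-const {zero}  c = refl
sum-const {suc n} c = cong (c +_) (sum-const {n} c)

sum-*ˡ : ∀ {n} c (f : Fin n → ℕ) → sum (λ i → c * f i) ≡ c * sum f
sum-*ˡ c f = sym (*-distribˡ-sum c f)

sum-mono : ∀ {n} {f g : Fin n → ℕ} → (∀ i → f i ≤ g i) → sum f ≤ sum g
sum-mono {zero}  f≤g = z≤n
sum-mono {suc n} f≤g = ℕP.+-mono-≤ (f≤g fz) (sum-mono (f≤g ∘ fs))

sum-tight : ∀ {n} {f g : Fin n → ℕ} → (∀ i → f i ≤ g i) → sum g ≤ sum f → ∀ i → f i ≡ g i
sum-tight {suc n} {f} {g} f≤g g≤f fz = ℕP.≤-antisym (f≤g fz)
  (ℕP.+-cancelʳ-≤ (sum (f ∘ fs)) (g fz) (f fz)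
    (ℕP.≤-trans (ℕP.+-monoʳ-≤ (g fz) (sum-mono (f≤g ∘ fs))) g≤f))
sum-tight {suc n} {f} {g} f≤g g≤f (fs i) = sum-tight (f≤g ∘ fs)
  (ℕP.+-cancelˡ-≤ (f fz) _ _ (ℕP.≤-trans (ℕP.+-monoˡ-≤ (sum (g ∘ fs)) (f≤g fz)) g≤f)) i

sum-split : ∀ a k (h : Fin (a + k) → ℕ) → sum h ≡ sum (λ i → h (i ↑ˡ k)) + sum (λ j → h (a ↑ʳ j))
sum-split zero    k h = refl
sum-split (suc a) k h = trans (cong (h fz +_) (sum-split a k (h ∘ fs))) (sym (ℕP.+-assoc (h fz) _ _))

count-off-diagonal : ∀ {n} (u : Fin n) (b : Fin n → Bool) →
  sum (λ v → 𝟙 ((u ≠ v) ∧ b v)) + 𝟙 (b u) ≡ sum (λ v → 𝟙 (b v))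
count-off-diagonal {suc n} fz     b = ℕP.+-comm (sum (λ v → 𝟙 (b (fs v)))) (𝟙 (b fz))
count-off-diagonal {suc n} (fs u) b = trans (ℕP.+-assoc (𝟙 (b fz)) _ _) (cong (𝟙 (b fz) +_)
  (trans (cong (_+ 𝟙 (b (fs u))) (sum-cong-≗ (λ w → cong (λ z → 𝟙 (not z ∧ b (fs w))) (≟-suc w))))
         (count-off-diagonal u (b ∘ fs))))
  where
  ≟-suc : ∀ w → ⌊ fs u ≟ fs w ⌋ ≡ ⌊ u ≟ w ⌋
  ≟-suc w with u ≟ w
  ... | yes _ = refl
  ... | no _  = refl

Σ² : ∀ {n} → (Fin n → Fin n → ℕ) → ℕ
Σ² h = sum (λ u → sum (λ v → h u v))

Σ²-cong : ∀ {n} {h k : Fin n → Fin n → ℕ} → (∀ u v → h u v ≡ k u v) → Σ² h ≡ Σ² k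
Σ²-cong h≡k = sum-cong-≗ (λ u → sum-cong-≗ (h≡k u))

Σ²-+ : ∀ {n} (h k : Fin n → Fin n → ℕ) → Σ² (λ u v → h u v + k u v) ≡ Σ² h + Σ² k
Σ²-+ h k = trans (sum-cong-≗ (λ u → ∑-distrib-+ (h u) (k u))) (∑-distrib-+ (λ u → sum (h u)) (λ u → sum (k u)))

Σ²-*ˡ : ∀ {n} c (h : Fin n → Fin n → ℕ) → Σ² (λ u v → c * h u v) ≡ c * Σ² h
Σ²-*ˡ c h = trans (sum-cong-≗ (λ u → sum-*ˡ c (h u))) (sum-*ˡ c (λ u → sum (h u)))

_≺_ : ∀ {n} → Fin n → Fin n → Bool
u ≺ v = toℕ u <ᵇ toℕ v

≺⇒≢ : ∀ {n} {u v : Fin n} → (u ≺ v) ≡ true → u ≢ v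
≺⇒≢ {u = u} u≺u refl = ℕP.<-irrefl refl (ℕP.<ᵇ⇒< (toℕ u) (toℕ u) (subst T (sym u≺u) _))

≺-false : ∀ {n} {u v : Fin n} → toℕ v ≤ toℕ u → (u ≺ v) ≡ false
≺-false {u = u} {v} v≤u with u ≺ v in eq
... | false = refl
... | true  = ⊥-elim (ℕP.<⇒≱ (ℕP.<ᵇ⇒< (toℕ u) (toℕ v) (subst T (sym eq) _)) v≤u)

≺-true : ∀ {n} {u v : Fin n} → toℕ u < toℕ v → (u ≺ v) ≡ true
≺-true {u = u} {v} u<v with u ≺ v | ℕP.<⇒<ᵇ u<v
... | true | _ = refl

split-by-order : ∀ {n} (h : Fin n → Fin n → ℕ) → (∀ u → h u u ≡ 0) → ∀ u v →
  h u v ≡ 𝟙 (u ≺ v) * h u v + 𝟙 (v ≺ u) * h u v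
split-by-order h h-diag u v with ℕP.<-cmp (toℕ u) (toℕ v)
... | tri< u<v _ _ rewrite ≺-true u<v | ≺-false {u = v} (ℕP.<⇒≤ u<v) = first (h u v)
  where first : ∀ x → x ≡ 1 * x + 0 * x
        first = solve-∀
... | tri> _ _ v<u rewrite ≺-true v<u | ≺-false {u = u} (ℕP.<⇒≤ v<u) = second (h u v)
  where second : ∀ x → x ≡ 0 * x + 1 * x
        second = solve-∀
... | tri≈ _ u≡v _ rewrite FinP.toℕ-injective u≡v | ≺-false {u = v} {v} ℕP.≤-refl = h-diag v

Σ²-symmetric : ∀ {n} (h : Fin n → Fin n → ℕ) → (∀ u → h u u ≡ 0) → (∀ u v → h u v ≡ h v u) →
  Σ² h ≡ 2 * Σ² (λ u v → 𝟙 (u ≺ v) * h u v)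
Σ²-symmetric h h-diag h-sym = begin
  Σ² h                          ≡⟨ Σ²-cong (split-by-order h h-diag) ⟩
  Σ² (λ u v → below u v + above u v) ≡⟨ Σ²-+ below above ⟩
  Σ² below + Σ² above           ≡⟨ cong (Σ² below +_) (∑-comm above) ⟩
  Σ² below + Σ² (λ v u → above u v) ≡⟨ cong (Σ² below +_) (Σ²-cong (λ v u → cong (𝟙 (v ≺ u) *_) (h-sym u v))) ⟩
  Σ² below + Σ² below           ≡⟨ cong (Σ² below +_) (sym (ℕP.+-identityʳ _)) ⟩
  2 * Σ² below                  ∎
  where
  open ≡-Reasoning
  below above : _ → _ → ℕ
  below u v = 𝟙 (u ≺ v) * h u v
  above u v = 𝟙 (v ≺ u) * h u v

-- The reciprocal distances that matter are 1 = 4/4 and 1/2 = 2/4,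
-- so the Harary estimate is an estimate of quarters a/4, a ∈ ℕ, carried out
-- in ℕ and transported to ℚ through `quarter`.

-- The rational a/(c+1), i.e. the normalisation of the unnormalised a/(c+1).
frac : ℕ → ℕ → ℚ
frac a c = fromℚᵘ (mkℚᵘ (ℤ.+ a) c)

quarter : ℕ → ℚ
quarter a = frac a 3

fromℚᵘ-mono-≤ : ∀ {x y} → x ℚᵘ.≤ y → fromℚᵘ x ≤ℚ fromℚᵘ y
fromℚᵘ-mono-≤ {x} {y} x≤y = ℚP.toℚᵘ-cancel-≤
  (ℚᵘP.≤-respʳ-≃ (ℚᵘP.≃-sym (ℚP.toℚᵘ-fromℚᵘ y)) (ℚᵘP.≤-respˡ-≃ (ℚᵘP.≃-sym (ℚP.toℚᵘ-fromℚᵘ x)) x≤y))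

frac-≤ : ∀ a c b d → a * suc d ≤ b * suc c → frac a c ≤ℚ frac b d
frac-≤ a c b d le =
  fromℚᵘ-mono-≤ {mkℚᵘ (ℤ.+ a) c} {mkℚᵘ (ℤ.+ b) d} (*≤* (subst₂ ℤ._≤_ (ℤP.pos-* a (suc d)) (ℤP.pos-* b (suc c)) (ℤ.+≤+ le)))

frac-≡ : ∀ a c b d → a * suc d ≡ b * suc c → frac a c ≡ frac b d
frac-≡ a c b d eq =
  ℚP.fromℚᵘ-cong {mkℚᵘ (ℤ.+ a) c} {mkℚᵘ (ℤ.+ b) d} (*≡* (trans (sym (ℤP.pos-* a (suc d))) (trans (cong ℤ.+_ eq) (ℤP.pos-* b (suc c)))))

quarter-mono : ∀ {a b} → a ≤ b → quarter a ≤ℚ quarter b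
quarter-mono {a} {b} le = frac-≤ a 3 b 3 (ℕP.*-monoˡ-≤ 4 le)

quarter-cancel : ∀ {a b} → quarter a ≤ℚ quarter b → a ≤ b
quarter-cancel {a} {b} le = ℕP.*-cancelʳ-≤ a b 4
  (ℤP.drop‿+≤+ (subst₂ ℤ._≤_ (sym (ℤP.pos-* a 4)) (sym (ℤP.pos-* b 4)) (ℚᵘP.drop-*≤* unnormalised)))
  where
  unnormalised : mkℚᵘ (ℤ.+ a) 3 ℚᵘ.≤ mkℚᵘ (ℤ.+ b) 3
  unnormalised = ℚᵘP.≤-respʳ-≃ (ℚP.toℚᵘ-fromℚᵘ (mkℚᵘ (ℤ.+ b) 3))
    (ℚᵘP.≤-respˡ-≃ (ℚP.toℚᵘ-fromℚᵘ (mkℚᵘ (ℤ.+ a) 3)) (ℚP.toℚᵘ-mono-≤ le))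

quarter-+ : ∀ a b → quarter a +ℚ quarter b ≡ quarter (a + b)
quarter-+ a b = ℚP.toℚᵘ-injective (begin
  toℚᵘ (quarter a +ℚ quarter b)                  ≈⟨ ℚP.toℚᵘ-homo-+ (quarter a) (quarter b) ⟩
  toℚᵘ (quarter a) ℚᵘ.+ toℚᵘ (quarter b)      ≈⟨ ℚᵘP.+-cong (ℚP.toℚᵘ-fromℚᵘ (mkℚᵘ (ℤ.+ a) 3)) (ℚP.toℚᵘ-fromℚᵘ (mkℚᵘ (ℤ.+ b) 3)) ⟩
  mkℚᵘ (ℤ.+ a) 3 ℚᵘ.+ mkℚᵘ (ℤ.+ b) 3               ≈⟨ *≡* (trans (cross (ℤ.+ a) (ℤ.+ b)) (cong (ℤ._* ℤ.+ 16) (sym (ℤP.pos-+ a b)))) ⟩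
  mkℚᵘ (ℤ.+ (a + b)) 3                               ≈⟨ ℚᵘP.≃-sym (ℚP.toℚᵘ-fromℚᵘ (mkℚᵘ (ℤ.+ (a + b)) 3)) ⟩
  toℚᵘ (quarter (a + b))                          ∎)
  where
  open ℚᵘP.≃-Reasoning
  cross : ∀ (x y : ℤ) → (x ℤ.* ℤ.+ 4 ℤ.+ y ℤ.* ℤ.+ 4) ℤ.* ℤ.+ 4 ≡ (x ℤ.+ y) ℤ.* ℤ.+ 16
  cross = ℤSolver.solve-∀

bound-quarter : ∀ X Y Z → X ≡ 2 * Z + Y → (ℤ.+ X -ℤ ℤ.+ Y) /ℚ 8 ≡ quarter Z
bound-quarter _ Y Z refl = trans (cong (_/ℚ 8) difference) (frac-≡ (2 * Z) 7 Z 3 (eighths Z))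
  where
  difference : ℤ.+ (2 * Z + Y) -ℤ ℤ.+ Y ≡ ℤ.+ (2 * Z)
  difference = trans (ℤP.m-n≡m⊖n (2 * Z + Y) Y)
    (trans (ℤP.⊖-≥ (ℕP.m≤n+m Y (2 * Z))) (cong ℤ.+_ (ℕP.m+n∸n≡m (2 * Z) Y)))
  eighths : ∀ z → 2 * z * 4 ≡ z * 8
  eighths = solve-∀

recip-≤-one : ∀ d → 1 ≤ d → recip d ≤ℚ quarter 4
recip-≤-one (suc k) _ = frac-≤ 1 k 4 3 (ℕP.*-monoʳ-≤ 4 (s≤s z≤n))

recip-≤-half : ∀ d → 2 ≤ d → recip d ≤ℚ quarter 2
recip-≤-half (suc zero)    (s≤s ())
recip-≤-half (suc (suc k)) _ = frac-≤ 1 (suc k) 2 3 (ℕP.*-monoʳ-≤ 2 {2} {suc (suc k)} (s≤s (s≤s z≤n)))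

sumℚ-≤ : ∀ {n} (h : Fin n → ℚ) (g : Fin n → ℕ) → (∀ i → h i ≤ℚ quarter (g i)) →
  sumℚ (tabulate h) ≤ℚ quarter (sum g)
sumℚ-≤ {zero}  h g h≤g = ℚP.≤-refl
sumℚ-≤ {suc n} h g h≤g = subst (sumℚ (tabulate h) ≤ℚ_) (quarter-+ (g fz) (sum (g ∘ fs)))
  (ℚP.+-mono-≤ (h≤g fz) (sumℚ-≤ (h ∘ fs) (g ∘ fs) (h≤g ∘ fs)))

sumℚ-≡ : ∀ {n} (h : Fin n → ℚ) (g : Fin n → ℕ) → (∀ i → h i ≡ quarter (g i)) →
  sumℚ (tabulate h) ≡ quarter (sum g)
sumℚ-≡ {zero}  h g h≡g = refl
sumℚ-≡ {suc n} h g h≡g =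
  trans (cong₂ _+ℚ_ (h≡g fz) (sumℚ-≡ (h ∘ fs) (g ∘ fs) (h≡g ∘ fs))) (quarter-+ (g fz) (sum (g ∘ fs)))

any-intro : ∀ {A : Set} {n} (p : A → Bool) (k : Fin n → A) i → p (k i) ≡ true → any p (tabulate k) ≡ true
any-intro p k fz     hit rewrite hit = refl
any-intro p k (fs i) hit with p (k fz)
... | true  = refl
... | false = any-intro p (k ∘ fs) i hit

any-elim : ∀ {A : Set} {n} (p : A → Bool) (k : Fin n → A) → any p (tabulate k) ≡ true → ∃ λ i → p (k i) ≡ true
any-elim {n = suc n} p k found with p (k fz) in hit
... | true  = fz , hit
... | false with any-elim p (k ∘ fs) found
... | i , hit′ = fs i , hit′

∧-true : ∀ {a b} → (a ∧ b) ≡ true → (a ≡ true) × (b ≡ true)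
∧-true {true} {true} _ = refl , refl

module _ {n} (G : Graph n) where

  reach-0 : ∀ {u v} → u ≢ v → reach G 0 u v ≡ false
  reach-0 = ≟-≢

  reach-1 : ∀ u v → reach G 1 u v ≡ adj G u v
  reach-1 u v with adj G u v in uv
  ... | true  = any-intro _ id v (subst (λ z → (z ∧ ⌊ v ≟ v ⌋) ≡ true) (sym uv) (≟-refl v))
  ... | false with reach G 1 u v in walk
  ...   | false = refl
  ...   | true with any-elim _ id walk
  ...     | w , step with ∧-true {adj G u w} step
  ...       | uw , w≟v with ≟-≡ w≟v
  ...         | refl with trans (sym uw) uv
  ...           | ()

  reach-2 : ∀ {u v w} → adj G u w ≡ true → adj G w v ≡ true → reach G 2 u v ≡ true
  reach-2 {u} {v} {w} uw wv = any-intro (λ x → adj G u x ∧ reach G 1 x v) id w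
    (subst₂ (λ y z → (y ∧ z) ≡ true) (sym uw) (sym (trans (reach-1 w v) wv)) refl)

  minReach-≥ : ∀ u v fuel k → k ≤ minReach G u v fuel k
  minReach-≥ u v zero       k = ℕP.≤-refl
  minReach-≥ u v (suc fuel) k with reach G k u v
  ... | true  = ℕP.≤-refl
  ... | false = ℕP.<⇒≤ (minReach-≥ u v fuel (suc k))

dist-≥1 : ∀ {n} (G : Graph n) {u v} → u ≢ v → 1 ≤ dist G u v
dist-≥1 {suc fuel} G {u} {v} u≢v rewrite reach-0 G u≢v = minReach-≥ G u v fuel 1

dist-≥2 : ∀ {n} (G : Graph n) {u v} → u ≢ v → adj G u v ≡ false → 2 ≤ dist G u v
dist-≥2 {suc zero} G {fz} {fz} u≢v _ = ⊥-elim (u≢v refl)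
dist-≥2 {suc (suc fuel)} G {u} {v} u≢v uv rewrite reach-0 G u≢v | reach-1 G u v | uv =
  minReach-≥ G u v fuel 2

dist-≡1 : ∀ {n} (G : Graph n) {u v} → u ≢ v → adj G u v ≡ true → dist G u v ≡ 1
dist-≡1 {suc zero} G {fz} {fz} u≢v _ = ⊥-elim (u≢v refl)
dist-≡1 {suc (suc fuel)} G {u} {v} u≢v uv rewrite reach-0 G u≢v | reach-1 G u v | uv = refl

-- The search for walks covers lengths 0 … n-1, so it finds length 2 once n ≥ 3.
dist-≡2 : ∀ {n} (G : Graph n) {u v w} → 3 ≤ n → u ≢ v → adj G u v ≡ false →
  adj G u w ≡ true → adj G w v ≡ true → dist G u v ≡ 2
dist-≡2 {suc (suc (suc fuel))} G {u} {v} _ u≢v uv uw wv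
  rewrite reach-0 G u≢v | reach-1 G u v | uv | reach-2 G uw wv = refl
dist-≡2 {suc zero}       G (s≤s ())         _ _ _ _
dist-≡2 {suc (suc zero)} G (s≤s (s≤s ())) _ _ _ _

-- On a pair u < v, 4/d(u,v) is at most 4 on an edge
-- and at most 2 on a non-edge, with equality when d(u,v) ≤ 2; `weight G`
-- sums these bounds, so H(G) ≤ weight G / 4, with equality for graphs in
-- which every two non-adjacent vertices have a common neighbour.
module _ {n} (G : Graph n) where

  pairWeight : Fin n → Fin n → ℕ
  pairWeight u v = if u ≺ v then (if adj G u v then 4 else 2) else 0

  weight : ℕ
  weight = Σ² pairWeight

  Diameter≤2 : Set
  Diameter≤2 = ∀ u v → u ≢ v → adj G u v ≡ false → ∃ λ w → (adj G u w ≡ true) × (adj G w v ≡ true)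

  private
    term : Fin n → Fin n → ℚ
    term u v = if u ≺ v then recip (dist G u v) else 0ℚ

    harary-tabulated : harary G ≡ sumℚ (tabulate (λ u → sumℚ (tabulate (term u))))
    harary-tabulated = cong sumℚ (trans (ListP.map-tabulate id _)
      (ListP.tabulate-cong (λ u → cong sumℚ (ListP.map-tabulate id (term u)))))

    term-≤ : ∀ u v → term u v ≤ℚ quarter (pairWeight u v)
    term-≤ u v with u ≺ v in u≺v
    ... | false = ℚP.≤-refl
    ... | true with adj G u v in uv
    ...   | true  = recip-≤-one _ (dist-≥1 G (≺⇒≢ u≺v))
    ...   | false = recip-≤-half _ (dist-≥2 G (≺⇒≢ u≺v) uv)

    term-≡ : 3 ≤ n → Diameter≤2 → ∀ u v → term u v ≡ quarter (pairWeight u v)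
    term-≡ 3≤n diam u v with u ≺ v in u≺v
    ... | false = refl
    ... | true with adj G u v in uv
    ...   | true = cong recip (dist-≡1 G (≺⇒≢ u≺v) uv)
    ...   | false with diam u v (≺⇒≢ u≺v) uv
    ...     | w , uw , wv = cong recip (dist-≡2 G 3≤n (≺⇒≢ u≺v) uv uw wv)

  harary-≤-weight : harary G ≤ℚ quarter weight
  harary-≤-weight = subst (_≤ℚ quarter weight) (sym harary-tabulated)
    (sumℚ-≤ _ (λ u → sum (pairWeight u)) (λ u → sumℚ-≤ (term u) (pairWeight u) (term-≤ u)))

  harary-≡-weight : 3 ≤ n → Diameter≤2 → harary G ≡ quarter weight
  harary-≡-weight 3≤n diam = trans harary-tabulated
    (sumℚ-≡ _ (λ u → sum (pairWeight u)) (λ u → sumℚ-≡ (term u) (pairWeight u) (term-≡ 3≤n diam u)))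

-- Counting ordered pairs.  `arcs r` is the number of ordered pairs related
-- by r; for the adjacency of a graph it is twice the number of edges.
arcs : ∀ {n} → (Fin n → Fin n → Bool) → ℕ
arcs r = Σ² (λ u v → 𝟙 (r u v))

arcs-≠ : ∀ n → arcs (_≠_ {n}) + n ≡ n * n
arcs-≠ n = begin
  arcs (_≠_ {n}) + n                           ≡⟨ cong (arcs (_≠_ {n}) +_) (sym (trans (sum-const {n} 1) (ℕP.*-identityʳ n))) ⟩
  arcs (_≠_ {n}) + sum {n} (λ _ → 1)          ≡⟨ sym (∑-distrib-+ {n} (λ u → sum (λ v → 𝟙 (u ≠ v))) (λ _ → 1)) ⟩
  sum {n} (λ u → sum (λ v → 𝟙 (u ≠ v)) + 1)    ≡⟨ sum-cong-≗ row ⟩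
  sum {n} (λ _ → n)                            ≡⟨ sum-const {n} n ⟩
  n * n                                        ∎
  where
  open ≡-Reasoning
  row : ∀ (u : Fin n) → sum (λ v → 𝟙 (u ≠ v)) + 1 ≡ n
  row u = trans (cong (_+ 1) (sum-cong-≗ (λ v → cong 𝟙 (sym (BoolP.∧-identityʳ (u ≠ v))))))
    (trans (count-off-diagonal u (λ _ → true)) (trans (sum-const {n} 1) (ℕP.*-identityʳ n)))

module _ {n} (G : Graph n) where

  private
    pairWeight-split : ∀ u v →
      pairWeight G u v ≡ 2 * (𝟙 (u ≺ v) * 𝟙 (u ≠ v)) + 2 * (𝟙 (u ≺ v) * 𝟙 (adj G u v))
    pairWeight-split u v with u ≺ v in u≺v
    ... | false = refl
    ... | true with u ≟ v | adj G u v
    ...   | yes u≡v | _     = ⊥-elim (≺⇒≢ u≺v u≡v)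
    ...   | no _    | true  = refl
    ...   | no _    | false = refl

  -- The weight counts every pair u < v twice and every edge twice more:
  -- weight G = (n² - n) + 2|E(G)|.
  weight-arcs : weight G + n ≡ n * n + arcs (adj G)
  weight-arcs = begin
    weight G + n                                  ≡⟨ cong (_+ n) (Σ²-cong pairWeight-split) ⟩
    Σ² (λ u v → 2 * below _≠_ u v + 2 * below (adj G) u v) + n
                                                  ≡⟨ cong (_+ n) (trans (Σ²-+ (λ u v → 2 * below _≠_ u v) (λ u v → 2 * below (adj G) u v))
                                                      (cong₂ _+_ (Σ²-*ˡ 2 (below _≠_)) (Σ²-*ˡ 2 (below (adj G))))) ⟩
    2 * Σ² (below _≠_) + 2 * Σ² (below (adj G)) + n
                                                  ≡⟨ cong (_+ n) (sym (cong₂ _+_ distinct edges)) ⟩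
    arcs (_≠_ {n}) + arcs (adj G) + n             ≡⟨ swap (arcs (_≠_ {n})) (arcs (adj G)) n ⟩
    (arcs (_≠_ {n}) + n) + arcs (adj G)                 ≡⟨ cong (_+ arcs (adj G)) (arcs-≠ n) ⟩
    n * n + arcs (adj G)                          ∎
    where
    open ≡-Reasoning
    below : (Fin n → Fin n → Bool) → Fin n → Fin n → ℕ
    below r u v = 𝟙 (u ≺ v) * 𝟙 (r u v)
    distinct : arcs (_≠_ {n}) ≡ 2 * Σ² (below _≠_)
    distinct = Σ²-symmetric {n} (λ u v → 𝟙 (u ≠ v)) (λ u → cong 𝟙 (≠-irrefl u)) (λ u v → cong 𝟙 (≠-sym u v))
    edges : arcs (adj G) ≡ 2 * Σ² (below (adj G))
    edges = Σ²-symmetric (λ u v → 𝟙 (adj G u v)) (λ u → cong 𝟙 (irrefl G u)) (λ u v → cong 𝟙 (Graph.sym G u v))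
    swap : ∀ a b c → a + b + c ≡ (a + c) + b
    swap = solve-∀

arcs-≅ : ∀ {n k} {G : Graph n} {H : Graph k} → G ≅ H → arcs (adj G) ≡ arcs (adj H)
arcs-≅ {G = G} {H} (f , adj≡) = begin
  Σ² (λ u v → 𝟙 (adj G u v))                                    ≡⟨ Σ²-cong (λ u v → cong 𝟙 (adj≡ u v)) ⟩
  sum (λ u → sum (λ v → 𝟙 (adj H (Inverse.to f u) (Inverse.to f v)))) ≡⟨ sum-cong-≗ (λ u → sym (sum-permute (λ y → 𝟙 (adj H (Inverse.to f u) y)) f)) ⟩
  sum (λ u → sum (λ y → 𝟙 (adj H (Inverse.to f u) y)))          ≡⟨ sym (sum-permute (λ x → sum (λ y → 𝟙 (adj H x y))) f) ⟩
  Σ² (λ x y → 𝟙 (adj H x y))                                    ∎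
  where open ≡-Reasoning

Universal : ∀ {n} → Graph n → Fin n → Set
Universal G w = ∀ v → w ≢ v → adj G w v ≡ true

universal⇒diameter≤2 : ∀ {n} (G : Graph n) {w} → Universal G w → Diameter≤2 G
universal⇒diameter≤2 G {w} univ u v u≢v uv = w , trans (Graph.sym G u w) (univ u w≢u) , univ v w≢v
  where
  w≢u : w ≢ u
  w≢u refl with trans (sym (univ v u≢v)) uv
  ... | ()
  w≢v : w ≢ v
  w≢v refl with trans (sym (trans (Graph.sym G u w) (univ u (u≢v ∘ sym)))) uv
  ... | ()

universal-≅ : ∀ {n k} {G : Graph n} {H : Graph k} (iso : G ≅ H) {w} →
  Universal H w → Universal G (Inverse.from (proj₁ iso) w)
universal-≅ {G = G} {H} (f , adj≡) {w} univ v w′≢v =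
  trans (adj≡ _ v) (trans (cong (λ x → adj H x (Inverse.to f v)) (Inverse.strictlyInverseˡ f w))
    (univ (Inverse.to f v) w≢fv))
  where
  w≢fv : w ≢ Inverse.to f v
  w≢fv w≡fv = w′≢v (trans (cong (Inverse.from f) w≡fv) (Inverse.strictlyInverseʳ f v))

-- A labelling κ : V → {0,1,2} determines the join
-- K_{c₀} ∨ (K̄_{c₁} ∨ K̄_{c₂}) of its classes: two distinct vertices are
-- adjacent unless they lie in the same class 1 or 2 (this is `classAdj` of
-- Defs, and KmJoinKab m a b is the join of the labelling `part m a b`).
ThreeClass : ∀ {n} → (Fin n → ℕ) → Set
ThreeClass κ = ∀ u → κ u ≤ 2

classSize : ∀ {n} → (Fin n → ℕ) → ℕ → ℕ
classSize κ j = sum (λ u → 𝟙 ⌊ κ u ℕ.≟ j ⌋)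

joinOf : ∀ {n} → (Fin n → ℕ) → Fin n → Fin n → Bool
joinOf κ u v = (u ≠ v) ∧ classAdj (κ u) (κ v)

module _ {n} (κ : Fin n → ℕ) (three : ThreeClass κ) where

  private
    c₀ c₁ c₂ : ℕ
    c₀ = classSize κ 0
    c₁ = classSize κ 1
    c₂ = classSize κ 2

  class-sum : ∀ (h : ℕ → ℕ) → sum (λ u → h (κ u)) ≡ h 0 * c₀ + h 1 * c₁ + h 2 * c₂
  class-sum h = begin
    sum (λ u → h (κ u))                             ≡⟨ sum-cong-≗ by-class ⟩
    sum (λ u → h 0 * ⟦ 0 ⟧ u + h 1 * ⟦ 1 ⟧ u + h 2 * ⟦ 2 ⟧ u)
                                                    ≡⟨ ∑-distrib-+ (λ u → h 0 * ⟦ 0 ⟧ u + h 1 * ⟦ 1 ⟧ u) (λ u → h 2 * ⟦ 2 ⟧ u) ⟩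
    sum (λ u → h 0 * ⟦ 0 ⟧ u + h 1 * ⟦ 1 ⟧ u) + sum (λ u → h 2 * ⟦ 2 ⟧ u)
                                                    ≡⟨ cong (_+ sum (λ u → h 2 * ⟦ 2 ⟧ u)) (∑-distrib-+ (λ u → h 0 * ⟦ 0 ⟧ u) (λ u → h 1 * ⟦ 1 ⟧ u)) ⟩
    sum (λ u → h 0 * ⟦ 0 ⟧ u) + sum (λ u → h 1 * ⟦ 1 ⟧ u) + sum (λ u → h 2 * ⟦ 2 ⟧ u)
                                                    ≡⟨ cong₂ _+_ (cong₂ _+_ (sum-*ˡ (h 0) (⟦ 0 ⟧)) (sum-*ˡ (h 1) (⟦ 1 ⟧))) (sum-*ˡ (h 2) (⟦ 2 ⟧)) ⟩
    h 0 * c₀ + h 1 * c₁ + h 2 * c₂                  ∎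
    where
    open ≡-Reasoning
    ⟦_⟧ : ℕ → Fin n → ℕ
    ⟦ j ⟧ u = 𝟙 ⌊ κ u ℕ.≟ j ⌋
    by-class : ∀ u → h (κ u) ≡ h 0 * ⟦ 0 ⟧ u + h 1 * ⟦ 1 ⟧ u + h 2 * ⟦ 2 ⟧ u
    by-class u with κ u | three u
    ... | 0 | _ = first (h 0) (h 1) (h 2)
      where first : ∀ x y z → x ≡ x * 1 + y * 0 + z * 0
            first = solve-∀
    ... | 1 | _ = second (h 0) (h 1) (h 2)
      where second : ∀ x y z → y ≡ x * 0 + y * 1 + z * 0
            second = solve-∀
    ... | 2 | _ = third (h 0) (h 1) (h 2)
      where third : ∀ x y z → z ≡ x * 0 + y * 0 + z * 1
            third = solve-∀
    ... | suc (suc (suc _)) | s≤s (s≤s ())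

  classSize-total : c₀ + c₁ + c₂ ≡ n
  classSize-total = trans (ones c₀ c₁ c₂) (trans (sym (class-sum (λ _ → 1))) (trans (sum-const {n} 1) (ℕP.*-identityʳ n)))
    where ones : ∀ x y z → x + y + z ≡ 1 * x + 1 * y + 1 * z
          ones = solve-∀

  -- Twice the number of edges of the join, for class sizes x, y, z: every
  -- vertex is adjacent to all vertices outside its own class, and a vertex
  -- of class 0 also to the rest of class 0.
  arcs-joinOf : ∀ {x y z} → c₀ ≡ x → c₁ ≡ y → c₂ ≡ z → arcs (joinOf κ) + x ≡ n * x + (x + z) * y + (x + y) * z
  arcs-joinOf refl refl refl = begin
    arcs (joinOf κ) + c₀                             ≡⟨ cong (arcs (joinOf κ) +_) (sym loops) ⟩
    arcs (joinOf κ) + sum (λ u → 𝟙 (classAdj (κ u) (κ u)))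
                                                     ≡⟨ sym (∑-distrib-+ (λ u → sum (λ v → 𝟙 (joinOf κ u v))) (λ u → 𝟙 (classAdj (κ u) (κ u)))) ⟩
    sum (λ u → sum (λ v → 𝟙 (joinOf κ u v)) + 𝟙 (classAdj (κ u) (κ u)))
                                                     ≡⟨ sum-cong-≗ degree ⟩
    sum (λ u → neighbours (κ u))                     ≡⟨ class-sum neighbours ⟩
    neighbours 0 * c₀ + neighbours 1 * c₁ + neighbours 2 * c₂
                                                     ≡⟨ collect c₀ c₁ c₂ ⟩
    (c₀ + c₁ + c₂) * c₀ + (c₀ + c₂) * c₁ + (c₀ + c₁) * c₂
                                                     ≡⟨ cong (λ z → z * c₀ + (c₀ + c₂) * c₁ + (c₀ + c₁) * c₂) classSize-total ⟩
    n * c₀ + (c₀ + c₂) * c₁ + (c₀ + c₁) * c₂         ∎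
    where
    open ≡-Reasoning
    -- the number of vertices w ≠ u adjacent to u, plus one if u is in class 0
    neighbours : ℕ → ℕ
    neighbours j = 𝟙 (classAdj j 0) * c₀ + 𝟙 (classAdj j 1) * c₁ + 𝟙 (classAdj j 2) * c₂
    degree : ∀ u → sum (λ v → 𝟙 (joinOf κ u v)) + 𝟙 (classAdj (κ u) (κ u)) ≡ neighbours (κ u)
    degree u = trans (count-off-diagonal u (λ v → classAdj (κ u) (κ v))) (class-sum (λ k → 𝟙 (classAdj (κ u) k)))
    loops : sum (λ u → 𝟙 (classAdj (κ u) (κ u))) ≡ c₀
    loops = trans (class-sum (λ k → 𝟙 (classAdj k k))) (only-first c₀ c₁ c₂)
      where only-first : ∀ x y z → 1 * x + 0 * y + 0 * z ≡ x
            only-first = solve-∀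
    collect : ∀ x y z → (1 * x + 1 * y + 1 * z) * x + (1 * x + 0 * y + 1 * z) * y + (1 * x + 1 * y + 0 * z) * z
                      ≡ (x + y + z) * x + (x + z) * y + (x + y) * z
    collect = solve-∀

-- The isomorphism sorts the vertices by
-- class: first into three tagged blocks, then into consecutive segments.
Blocks : ℕ → ℕ → ℕ → Set
Blocks a b c = Fin a ⊎ (Fin b ⊎ Fin c)

tag : ∀ {a b c} → Blocks a b c → ℕ
tag (inj₁ _)        = 0
tag (inj₂ (inj₁ _)) = 1
tag (inj₂ (inj₂ _)) = 2

module _ {n a : ℕ} {B : Set} (σ : Fin n ↔ (Fin a ⊎ B)) where

  private
    push : Fin a ⊎ B → Fin (suc a) ⊎ B
    push = Sum.map₁ fs

    to : Fin (suc n) → Fin (suc a) ⊎ B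
    to fz     = inj₁ fz
    to (fs x) = push (Inverse.to σ x)

    from : Fin (suc a) ⊎ B → Fin (suc n)
    from (inj₁ fz)     = fz
    from (inj₁ (fs i)) = fs (Inverse.from σ (inj₁ i))
    from (inj₂ y)      = fs (Inverse.from σ (inj₂ y))

    to-from : ∀ y → to (from y) ≡ y
    to-from (inj₁ fz)     = refl
    to-from (inj₁ (fs i)) = cong push (Inverse.strictlyInverseˡ σ (inj₁ i))
    to-from (inj₂ y)      = cong push (Inverse.strictlyInverseˡ σ (inj₂ y))

    from-to : ∀ x → from (to x) ≡ x
    from-to fz     = refl
    from-to (fs x) with Inverse.to σ x in σx
    ... | inj₁ i = cong fs (trans (cong (Inverse.from σ) (sym σx)) (Inverse.strictlyInverseʳ σ x))
    ... | inj₂ y = cong fs (trans (cong (Inverse.from σ) (sym σx)) (Inverse.strictlyInverseʳ σ x))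

  cons-block : Fin (suc n) ↔ (Fin (suc a) ⊎ B)
  cons-block = mk↔ₛ′ to from to-from from-to

private
  swap₁ : ∀ {X Y Z : Set} → X ⊎ (Y ⊎ Z) → Y ⊎ (X ⊎ Z)
  swap₁ (inj₁ x)        = inj₂ (inj₁ x)
  swap₁ (inj₂ (inj₁ y)) = inj₁ y
  swap₁ (inj₂ (inj₂ z)) = inj₂ (inj₂ z)

  swap₁-swap₁ : ∀ {X Y Z : Set} (w : X ⊎ (Y ⊎ Z)) → swap₁ (swap₁ w) ≡ w
  swap₁-swap₁ (inj₁ x)        = refl
  swap₁-swap₁ (inj₂ (inj₁ y)) = refl
  swap₁-swap₁ (inj₂ (inj₂ z)) = refl

  swap₂ : ∀ {X Y Z : Set} → X ⊎ (Y ⊎ Z) → Z ⊎ (Y ⊎ X)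
  swap₂ (inj₁ x)        = inj₂ (inj₂ x)
  swap₂ (inj₂ (inj₁ y)) = inj₂ (inj₁ y)
  swap₂ (inj₂ (inj₂ z)) = inj₁ z

  swap₂-swap₂ : ∀ {X Y Z : Set} (w : X ⊎ (Y ⊎ Z)) → swap₂ (swap₂ w) ≡ w
  swap₂-swap₂ (inj₁ x)        = refl
  swap₂-swap₂ (inj₂ (inj₁ y)) = refl
  swap₂-swap₂ (inj₂ (inj₂ z)) = refl

second-first : ∀ {X Y Z : Set} → (X ⊎ (Y ⊎ Z)) ↔ (Y ⊎ (X ⊎ Z))
second-first = mk↔ₛ′ swap₁ swap₁ swap₁-swap₁ swap₁-swap₁

third-first : ∀ {X Y Z : Set} → (X ⊎ (Y ⊎ Z)) ↔ (Z ⊎ (Y ⊎ X))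
third-first = mk↔ₛ′ swap₂ swap₂ swap₂-swap₂ swap₂-swap₂

sort-by-class : ∀ {n} (κ : Fin n → ℕ) → ThreeClass κ →
  Σ (Fin n ↔ Blocks (classSize κ 0) (classSize κ 1) (classSize κ 2))
    λ σ → ∀ u → tag (Inverse.to σ u) ≡ κ u
sort-by-class {zero} κ _ =
  mk↔ₛ′ (λ ()) (λ { (inj₁ ()) ; (inj₂ (inj₁ ())) ; (inj₂ (inj₂ ())) })
    (λ { (inj₁ ()) ; (inj₂ (inj₁ ())) ; (inj₂ (inj₂ ())) }) (λ ()) , λ ()
sort-by-class {suc n} κ three with sort-by-class (κ ∘ fs) (three ∘ fs)
... | σ , tagged with κ fz in κ₀ | three fz
... | 0 | _ = cons-block σ , λ { fz → sym κ₀ ; (fs x) → trans (keeps (Inverse.to σ x)) (tagged x) }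
  where
  keeps : ∀ {a b c} (y : Blocks a b c) → tag (Sum.map₁ fs y) ≡ tag y
  keeps (inj₁ _)        = refl
  keeps (inj₂ (inj₁ _)) = refl
  keeps (inj₂ (inj₂ _)) = refl
... | 1 | _ = second-first ↔-∘ cons-block (second-first ↔-∘ σ) ,
              λ { fz → sym κ₀ ; (fs x) → trans (keeps (Inverse.to σ x)) (tagged x) }
  where
  keeps : ∀ {a b c} (y : Blocks a b c) →
    tag (Inverse.to second-first (Sum.map₁ fs (Inverse.to (second-first {Fin a} {Fin b} {Fin c}) y))) ≡ tag y
  keeps (inj₁ _)        = refl
  keeps (inj₂ (inj₁ _)) = refl
  keeps (inj₂ (inj₂ _)) = refl
... | 2 | _ = third-first ↔-∘ cons-block (third-first ↔-∘ σ) ,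
              λ { fz → sym κ₀ ; (fs x) → trans (keeps (Inverse.to σ x)) (tagged x) }
  where
  keeps : ∀ {a b c} (y : Blocks a b c) →
    tag (Inverse.to third-first (Sum.map₁ fs (Inverse.to (third-first {Fin a} {Fin b} {Fin c}) y))) ≡ tag y
  keeps (inj₁ _)        = refl
  keeps (inj₂ (inj₁ _)) = refl
  keeps (inj₂ (inj₂ _)) = refl
... | suc (suc (suc _)) | s≤s (s≤s ())

segments : ∀ a b c → Fin (a + (b + c)) ↔ Blocks a b c
segments a b c = mk↔ₛ′ to from to-from from-to
  where
  to : Fin (a + (b + c)) → Blocks a b c
  to i = Sum.map₂ (splitAt b) (splitAt a i)
  from : Blocks a b c → Fin (a + (b + c))
  from y = join a (b + c) (Sum.map₂ (join b c) y)
  to-from : ∀ y → to (from y) ≡ y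
  to-from (inj₁ x) rewrite FinP.splitAt-join a (b + c) (inj₁ x) = refl
  to-from (inj₂ y) rewrite FinP.splitAt-join a (b + c) (inj₂ (join b c y)) | FinP.splitAt-join b c y = refl
  from-to : ∀ i → from (to i) ≡ i
  from-to i with splitAt a i in split
  ... | inj₁ x = trans (cong (join a (b + c)) (sym split)) (FinP.join-splitAt a (b + c) i)
  ... | inj₂ y rewrite FinP.join-splitAt b c y =
    trans (cong (join a (b + c)) (sym split)) (FinP.join-splitAt a (b + c) i)

part-segments : ∀ a b c i → part a b c i ≡ tag (Inverse.to (segments a b c) i)
part-segments a b c i with splitAt a i
... | inj₁ _ = refl
... | inj₂ j with splitAt b j
...   | inj₁ _ = refl
...   | inj₂ _ = refl

≠-↔ : ∀ {n k} (f : Fin n ↔ Fin k) (u v : Fin n) → (Inverse.to f u ≠ Inverse.to f v) ≡ (u ≠ v)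
≠-↔ f u v with u ≟ v | Inverse.to f u ≟ Inverse.to f v
... | yes refl | yes _    = refl
... | yes refl | no fu≢fv = ⊥-elim (fu≢fv refl)
... | no u≢v   | yes fu≡fv = ⊥-elim (u≢v (trans (sym (Inverse.strictlyInverseʳ f u))
                                  (trans (cong (Inverse.from f) fu≡fv) (Inverse.strictlyInverseʳ f v))))
... | no _     | no _     = refl

join-≅ : ∀ {n} (G : Graph n) (κ : Fin n → ℕ) → ThreeClass κ → (∀ u v → adj G u v ≡ joinOf κ u v) →
  G ≅ KmJoinKab (classSize κ 0) (classSize κ 1) (classSize κ 2)
join-≅ G κ three adj≡ with sort-by-class κ three
... | σ , tagged = F , λ u v → trans (adj≡ u v)
      (cong₂ _∧_ (sym (≠-↔ F u v)) (cong₂ classAdj (class u) (class v)))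
  where
  a = classSize κ 0
  b = classSize κ 1
  c = classSize κ 2
  F : Fin _ ↔ Fin (a + (b + c))
  F = ↔-sym (segments a b c) ↔-∘ σ
  class : ∀ u → κ u ≡ part a b c (Inverse.to F u)
  class u = sym (trans (part-segments a b c (Inverse.to F u))
    (trans (cong tag (Inverse.strictlyInverseˡ (segments a b c) (Inverse.to σ u))) (tagged u)))

threeClass-part : ∀ m a b → ThreeClass (part m a b)
threeClass-part m a b i rewrite part-segments m a b i
  with Inverse.to (segments m a b) i
... | inj₁ _        = z≤n
... | inj₂ (inj₁ _) = s≤s z≤n
... | inj₂ (inj₂ _) = s≤s (s≤s z≤n)

part-↑ˡ : ∀ m a b (i : Fin m) → part m a b (i ↑ˡ (a + b)) ≡ 0
part-↑ˡ m a b i rewrite part-segments m a b (i ↑ˡ (a + b)) | FinP.splitAt-↑ˡ m i (a + b) = refl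

classSize-part : ∀ m a b j →
  classSize (part m a b) j ≡ m * 𝟙 ⌊ 0 ℕ.≟ j ⌋ + (a * 𝟙 ⌊ 1 ℕ.≟ j ⌋ + b * 𝟙 ⌊ 2 ℕ.≟ j ⌋)
classSize-part m a b j = trans (sum-split m (a + b) _)
  (cong₂ _+_ (segment m (λ i → part-↑ˡ m a b i))
    (trans (sum-split a b _) (cong₂ _+_ (segment a middle) (segment b last))))
  where
  segment : ∀ {t} k {f : Fin k → Fin (m + (a + b))} → (∀ i → part m a b (f i) ≡ t) →
    sum (λ i → 𝟙 ⌊ part m a b (f i) ℕ.≟ j ⌋) ≡ k * 𝟙 ⌊ t ℕ.≟ j ⌋
  segment k in-class = trans (sum-cong-≗ (λ i → cong (λ z → 𝟙 ⌊ z ℕ.≟ j ⌋) (in-class i))) (sum-const {k} _)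
  middle : ∀ i → part m a b (m ↑ʳ (i ↑ˡ b)) ≡ 1
  middle i rewrite part-segments m a b (m ↑ʳ (i ↑ˡ b)) | FinP.splitAt-↑ʳ m (a + b) (i ↑ˡ b)
                 | FinP.splitAt-↑ˡ a i b = refl
  last : ∀ i → part m a b (m ↑ʳ (a ↑ʳ i)) ≡ 2
  last i rewrite part-segments m a b (m ↑ʳ (a ↑ʳ i)) | FinP.splitAt-↑ʳ m (a + b) (a ↑ʳ i)
               | FinP.splitAt-↑ʳ a b i = refl

KmJoinKab-universal : ∀ M a b → Universal (KmJoinKab (suc M) a b) (fz {M} ↑ˡ (a + b))
KmJoinKab-universal M a b v w≢v =
  trans (cong₂ _∧_ (cong not (≟-≢ w≢v)) (cong (λ z → classAdj z (part (suc M) a b v)) (part-↑ˡ (suc M) a b fz)))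
        (BoolP.∨-zeroʳ _)

-- A cover of G with parameter m is a three-class labelling whose
-- join contains G, with at most m vertices in class 0 and class 1 at least
-- as large as class 2.  Deleting ≤ m vertices to make G bipartite yields one.
record Cover {n} (G : Graph n) (m : ℕ) : Set where
  field
    label    : Fin n → ℕ
    three    : ThreeClass label
    covers   : ∀ u v → adj G u v ≡ true → joinOf label u v ≡ true
    small    : classSize label 0 ≤ m
    balanced : classSize label 2 ≤ classSize label 1

deletionLabel : ∀ {n} → Subset n → (Fin n → Bool) → Fin n → ℕ
deletionLabel S c u = if lookup S u then 0 else (if c u then 1 else 2)

ProperOutside : ∀ {n} → Graph n → Subset n → (Fin n → Bool) → Set
ProperOutside G S c = ∀ u v → u ∉ S → v ∉ S → adj G u v ≡ true → c u ≢ c v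

count-subset : ∀ {n} (S : Subset n) → sum (λ u → 𝟙 (lookup S u)) ≡ ∣ S ∣
count-subset []          = refl
count-subset (true ∷ S)  = cong suc (count-subset S)
count-subset (false ∷ S) = count-subset S

module _ {n} (S : Subset n) (c : Fin n → Bool) where

  deletion-three : ThreeClass (deletionLabel S c)
  deletion-three u with lookup S u | c u
  ... | true  | _     = z≤n
  ... | false | true  = s≤s z≤n
  ... | false | false = s≤s (s≤s z≤n)

  deletion-class₀ : classSize (deletionLabel S c) 0 ≡ ∣ S ∣
  deletion-class₀ = trans (sum-cong-≗ deleted) (count-subset S)
    where
    deleted : ∀ u → 𝟙 ⌊ deletionLabel S c u ℕ.≟ 0 ⌋ ≡ 𝟙 (lookup S u)
    deleted u with lookup S u | c u
    ... | true  | _     = refl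
    ... | false | true  = refl
    ... | false | false = refl

  recolour-classes : (classSize (deletionLabel S (not ∘ c)) 1 ≡ classSize (deletionLabel S c) 2)
                   × (classSize (deletionLabel S (not ∘ c)) 2 ≡ classSize (deletionLabel S c) 1)
  recolour-classes = sum-cong-≗ (proj₁ ∘ exchanged) , sum-cong-≗ (proj₂ ∘ exchanged)
    where
    exchanged : ∀ u → (𝟙 ⌊ deletionLabel S (not ∘ c) u ℕ.≟ 1 ⌋ ≡ 𝟙 ⌊ deletionLabel S c u ℕ.≟ 2 ⌋)
                    × (𝟙 ⌊ deletionLabel S (not ∘ c) u ℕ.≟ 2 ⌋ ≡ 𝟙 ⌊ deletionLabel S c u ℕ.≟ 1 ⌋)
    exchanged u with lookup S u | c u
    ... | true  | _     = refl , refl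
    ... | false | true  = refl , refl
    ... | false | false = refl , refl

  module _ {G : Graph n} (proper : ProperOutside G S c) where

    private
      outside : ∀ {u} → lookup S u ≡ false → u ∉ S
      outside {u} u∉S u∈S with trans (sym (VecP.[]=⇒lookup u∈S)) u∉S
      ... | ()

    deletion-covers : ∀ u v → adj G u v ≡ true → joinOf (deletionLabel S c) u v ≡ true
    deletion-covers u v uv with u ≟ v
    ... | yes refl with trans (sym uv) (irrefl G u)
    ...   | ()
    deletion-covers u v uv | no _ with lookup S u in Su | lookup S v in Sv | c u in cu | c v in cv
    ... | true  | true  | _     | _     = refl
    ... | true  | false | _     | true  = refl
    ... | true  | false | _     | false = refl
    ... | false | true  | true  | _     = refl
    ... | false | true  | false | _     = refl
    ... | false | false | true  | false = refl
    ... | false | false | false | true  = refl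
    ... | false | false | true  | true  = ⊥-elim (proper u v (outside Su) (outside Sv) uv (trans cu (sym cv)))
    ... | false | false | false | false = ⊥-elim (proper u v (outside Su) (outside Sv) uv (trans cu (sym cv)))

recolour-proper : ∀ {n} {G : Graph n} {S c} → ProperOutside G S c → ProperOutside G S (not ∘ c)
recolour-proper proper u v u∉S v∉S uv same = proper u v u∉S v∉S uv (BoolP.not-injective same)

deletion-cover : ∀ {n} {G : Graph n} {m} S c → ∣ S ∣ ≤ m → ProperOutside G S c →
  classSize (deletionLabel S c) 2 ≤ classSize (deletionLabel S c) 1 → Cover G m
deletion-cover {G = G} {m} S c |S|≤m proper ordered = record
  { label    = deletionLabel S c
  ; three    = deletion-three S c
  ; covers   = deletion-covers S c {G} proper
  ; small    = subst (_≤ m) (sym (deletion-class₀ S c)) |S|≤m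
  ; balanced = ordered }

v₂⇒cover : ∀ {n} {G : Graph n} {m} → V2AtMost G m → Cover G m
v₂⇒cover {G = G} (S , |S|≤m , c , proper)
  with ℕP.≤-total (classSize (deletionLabel S c) 2) (classSize (deletionLabel S c) 1)
... | inj₁ ordered  = deletion-cover S c |S|≤m proper ordered
... | inj₂ reversed = deletion-cover S (not ∘ c) |S|≤m (recolour-proper {G = G} {S} {c} proper)
  (subst₂ _≤_ (sym (proj₂ (recolour-classes S c))) (sym (proj₁ (recolour-classes S c))) reversed)

-- Isomorphic graphs on the same vertex set have the same weight, since the
-- weight is determined by the number of edges.
weight-≅ : ∀ {n} {G H : Graph n} → G ≅ H → weight G ≡ weight H
weight-≅ {n} {G} {H} iso = ℕP.+-cancelʳ-≡ n (weight G) (weight H)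
  (trans (weight-arcs G) (trans (cong (n * n +_) (arcs-≅ {G = G} {H} iso)) (sym (weight-arcs H))))

-- For a cover with class sizes s, b + t, b (t = c₁ - c₂) and
-- m = s + d, let E be the number of arcs of G and E + δ that of the join.
-- Combining weight G + n = n² + E with the edge count of the join gives
--   2·weight G + 2δ + t² + 2d(2b + t) + (m² + 2m + 2n) = 3n² + 2mn + d(d + 2).
join-identity : ∀ {n m} s b t d E δ D → n ≡ s + (b + t) + b → m ≡ s + d →
  (E + δ) + s ≡ n * s + (s + b) * (b + t) + (s + (b + t)) * b →
  D + n ≡ n * n + E →
  2 * D + 2 * δ + t * t + 2 * d * ((b + t) + b) + (m * m + 2 * m + 2 * n) ≡ 3 * n * n + 2 * m * n + d * (d + 2)
join-identity s b t d E δ D refl refl join-arcs weight-eq = ℕP.+-cancelʳ-≡ (2 * E + 2 * s) _ _ (begin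
  2 * D + 2 * δ + t * t + 2 * d * ((b + t) + b) + (m * m + 2 * m + 2 * n) + (2 * E + 2 * s)
      ≡⟨ regroup s b t d E δ D ⟩
  2 * (D + n) + 2 * ((E + δ) + s) + rest
      ≡⟨ cong₂ (λ x y → 2 * x + 2 * y + rest) weight-eq join-arcs ⟩
  2 * (n * n + E) + 2 * (n * s + (s + b) * (b + t) + (s + (b + t)) * b) + rest
      ≡⟨ expand s b t d E ⟩
  3 * n * n + 2 * m * n + d * (d + 2) + (2 * E + 2 * s) ∎)
  where
  open ≡-Reasoning
  n m rest : ℕ
  n = s + (b + t) + b
  m = s + d
  rest = t * t + 2 * d * ((b + t) + b) + (m * m + 2 * m)
  regroup : ∀ s b t d E δ D → let n = s + (b + t) + b ; m = s + d in
    2 * D + 2 * δ + t * t + 2 * d * ((b + t) + b) + (m * m + 2 * m + 2 * n) + (2 * E + 2 * s)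
    ≡ 2 * (D + n) + 2 * ((E + δ) + s) + (t * t + 2 * d * ((b + t) + b) + (m * m + 2 * m))
  regroup = solve-∀
  expand : ∀ s b t d E → let n = s + (b + t) + b ; m = s + d in
    2 * (n * n + E) + 2 * (n * s + (s + b) * (b + t) + (s + (b + t)) * b) + (t * t + 2 * d * ((b + t) + b) + (m * m + 2 * m))
    ≡ 3 * n * n + 2 * m * n + d * (d + 2) + (2 * E + 2 * s)
  expand = solve-∀

-- Writing 2b + t = d + 2 + w, the identity exhibits 3n² + 2mn - (m² + 2m + 2n)
-- as 2·weight G plus the slack 2δ + t² + d(d + 2) + 2dw.
excess-form : ∀ {X Y D δ t d r} w → d + 2 + w ≡ r →
  2 * D + 2 * δ + t * t + 2 * d * r + Y ≡ X + d * (d + 2) →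
  2 * D + (2 * δ + t * t + d * (d + 2) + 2 * d * w) + Y ≡ X
excess-form {X} {Y} {D} {δ} {t} {d} w refl identity =
  ℕP.+-cancelʳ-≡ (d * (d + 2)) _ X (trans (regroup D δ t d w Y) identity)
  where
  regroup : ∀ D δ t d w Y →
    2 * D + (2 * δ + t * t + d * (d + 2) + 2 * d * w) + Y + d * (d + 2) ≡ 2 * D + 2 * δ + t * t + 2 * d * (d + 2 + w) + Y
  regroup = solve-∀

half-≤ : ∀ {a b e r} → 2 * a + e ≡ 2 * b + r → r ≤ 1 → a ≤ b
half-≤ {a} {b} {e} {r} eq r≤1 = ℕP.≤-pred (ℕP.*-cancelˡ-< 2 a (suc b) (begin-strict
  2 * a      ≤⟨ ℕP.m≤m+n (2 * a) e ⟩
  2 * a + e  ≡⟨ eq ⟩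
  2 * b + r  ≤⟨ ℕP.+-monoʳ-≤ (2 * b) r≤1 ⟩
  2 * b + 1  <⟨ ℕP.≤-reflexive (next b) ⟩
  2 * suc b  ∎))
  where
  open ℕP.≤-Reasoning
  next : ∀ b → suc (2 * b + 1) ≡ 2 * suc b
  next = solve-∀

too-large : ∀ {k p} → 2 ≤ k → k ≡ p → p ≤ 1 → ⊥
too-large 2≤k refl k≤1 with ℕP.≤-trans 2≤k k≤1
... | s≤s ()

-- A slack of at most one forces d = 0, δ = 0 and t = p: otherwise the
-- summand d(d + 2), 2δ or t² alone is at least 2.
small-slack : ∀ δ t d w p → 2 * δ + t * t + d * (d + 2) + 2 * d * w ≡ p → p ≤ 1 →
  (d ≡ 0) × (δ ≡ 0) × (t ≡ p)
small-slack zero zero           zero w p slack _ = refl , refl , slack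
small-slack zero (suc zero)     zero w p slack _ = refl , refl , slack
small-slack zero (suc (suc t))  zero w p slack p≤1 = ⊥-elim (too-large
  (ℕP.≤-trans (s≤s (s≤s (z≤n {t}))) (ℕP.≤-trans (ℕP.m≤m*n (suc (suc t)) (suc (suc t)))
    (ℕP.≤-trans (ℕP.m≤m+n _ 0) (ℕP.m≤m+n _ 0)))) slack p≤1)
small-slack (suc δ) t zero w p slack p≤1 = ⊥-elim (too-large
  (ℕP.≤-trans (ℕP.*-monoʳ-≤ 2 (s≤s z≤n)) (ℕP.≤-trans (ℕP.m≤m+n _ (t * t)) (ℕP.≤-trans (ℕP.m≤m+n _ 0) (ℕP.m≤m+n _ 0))))
  slack p≤1)
small-slack δ t (suc d) w p slack p≤1 = ⊥-elim (too-large
  (ℕP.≤-trans (ℕP.m≤n+m 2 (suc d)) (ℕP.≤-trans (ℕP.m≤m+n (suc d + 2) (d * (suc d + 2)))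
    (ℕP.≤-trans (ℕP.m≤n+m _ (2 * δ + t * t)) (ℕP.m≤m+n _ (2 * suc d * w)))))
  slack p≤1)

double-+-injective : ∀ {b b′ p} → (b + p) + b ≡ (b′ + p) + b′ → b ≡ b′
double-+-injective {b} {b′} {p} eq = ℕP.*-cancelˡ-≡ b b′ 2
  (ℕP.+-cancelʳ-≡ p (2 * b) (2 * b′) (trans (twice b p) (trans eq (sym (twice b′ p)))))
  where
  twice : ∀ b p → 2 * b + p ≡ (b + p) + b
  twice = solve-∀

module CoverBound {n m} (G : Graph n) (C : Cover G m) (m+2≤n : m + 2 ≤ n) where

  open Cover C

  s b t d E δ r w slack : ℕ
  s = classSize label 0
  b = classSize label 2
  t = classSize label 1 ∸ b
  d = m ∸ s
  E = arcs (adj G)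
  δ = arcs (joinOf label) ∸ E
  r = (b + t) + b
  w = r ∸ (d + 2)
  slack = 2 * δ + t * t + d * (d + 2) + 2 * d * w

  private
    class₁ : classSize label 1 ≡ b + t
    class₁ = sym (ℕP.m+[n∸m]≡n balanced)

    covered : ∀ u v → 𝟙 (adj G u v) ≤ 𝟙 (joinOf label u v)
    covered u v with adj G u v in uv
    ... | false = z≤n
    ... | true  = ℕP.≤-reflexive (cong 𝟙 (sym (covers u v uv)))

    E≤ : E ≤ arcs (joinOf label)
    E≤ = sum-mono (λ u → sum-mono (covered u))

    sizes : n ≡ s + (b + t) + b
    sizes = trans (sym (classSize-total label three)) (cong (λ z → s + z + b) class₁)

    m≡s+d : m ≡ s + d
    m≡s+d = sym (ℕP.m+[n∸m]≡n small)

    join-arcs : (E + δ) + s ≡ n * s + (s + b) * (b + t) + (s + (b + t)) * b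
    join-arcs = trans (cong (_+ s) (ℕP.m+[n∸m]≡n E≤))
      (arcs-joinOf label three refl class₁ refl)

    -- n ≥ m + 2 means that the two colour classes have at least d + 2 vertices
    d+2+w≡r : d + 2 + w ≡ r
    d+2+w≡r = ℕP.m+[n∸m]≡n (ℕP.+-cancelˡ-≤ s (d + 2) r
      (subst₂ _≤_ (trans (cong (_+ 2) m≡s+d) (ℕP.+-assoc s d 2)) (trans sizes (ℕP.+-assoc s (b + t) b)) m+2≤n))

    s≡m : d ≡ 0 → s ≡ m
    s≡m d≡0 = sym (trans m≡s+d (trans (cong (s +_) d≡0) (ℕP.+-identityʳ s)))

    sizes-m : d ≡ 0 → n ≡ m + ((b + t) + b)
    sizes-m d≡0 = trans sizes (trans (ℕP.+-assoc s (b + t) b) (cong (_+ ((b + t) + b)) (s≡m d≡0)))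

    adj≡join : δ ≡ 0 → ∀ u v → adj G u v ≡ joinOf label u v
    adj≡join δ≡0 u v = 𝟙-injective (sum-tight (covered u) (ℕP.≤-reflexive (sym (row u))) v)
      where
      join≤E : arcs (joinOf label) ≤ E
      join≤E = ℕP.≤-reflexive (trans (sym (ℕP.m+[n∸m]≡n E≤)) (trans (cong (E +_) δ≡0) (ℕP.+-identityʳ E)))
      row : ∀ u → sum (λ v → 𝟙 (adj G u v)) ≡ sum (λ v → 𝟙 (joinOf label u v))
      row = sum-tight (λ u → sum-mono (covered u)) join≤E

  excess : 2 * weight G + slack + (m * m + 2 * m + 2 * n) ≡ 3 * n * n + 2 * m * n
  excess = excess-form {D = weight G} {δ} {t} {d} w d+2+w≡r
    (join-identity s b t d E δ (weight G) sizes m≡s+d join-arcs (weight-arcs G))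

  -- Without slack, G is the join of its cover: class 0 has m vertices and
  -- classes 1 and 2 differ by p, so their sizes are determined by n.
  no-slack : ∀ {p b′} → slack ≡ p → p ≤ 1 → n ≡ m + ((b′ + p) + b′) → G ≅ KmJoinKab m (b′ + p) b′
  no-slack {p} {b′} slack≡p p≤1 n≡ with small-slack δ t d w p slack≡p p≤1
  ... | d≡0 , δ≡0 , refl with double-+-injective {b} {b′} {t} (ℕP.+-cancelˡ-≡ m _ _ (trans (sym (sizes-m d≡0)) n≡))
  ... | refl = subst₂ (λ x y → G ≅ KmJoinKab x y b) (s≡m d≡0) class₁ (join-≅ G label three (adj≡join δ≡0))

-- The extremal graph K_m ∨ (K̄_{b+p} ∨ K̄_b) is its own cover without slack,
-- so its weight W satisfies 3n² + 2mn = 2W + (m² + 2m + 2n + p).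
extremal-weight : ∀ m b p → p ≤ 1 → let n = m + ((b + p) + b) in
  3 * n * n + 2 * m * n ≡ 2 * weight (KmJoinKab m (b + p) b) + (m * m + 2 * m + 2 * n + p)
extremal-weight m b p p≤1 = begin
  3 * n * n + 2 * m * n                      ≡⟨ sym (ℕP.+-identityʳ _) ⟩
  3 * n * n + 2 * m * n + 0 * (0 + 2)        ≡⟨ sym (join-identity m b p 0 E 0 W n≡ m≡ join-arcs (weight-arcs K)) ⟩
  2 * W + 2 * 0 + p * p + 2 * 0 * ((b + p) + b) + Y₀ ≡⟨ tidy W (p * p) ((b + p) + b) Y₀ ⟩
  2 * W + (Y₀ + p * p)                       ≡⟨ cong (λ q → 2 * W + (Y₀ + q)) (square p p≤1) ⟩
  2 * W + (Y₀ + p)                           ∎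
  where
  open ≡-Reasoning
  n = m + ((b + p) + b)
  K = KmJoinKab m (b + p) b
  E = arcs (adj K)
  W = weight K
  Y₀ = m * m + 2 * m + 2 * n
  n≡ : n ≡ m + (b + p) + b
  n≡ = sym (ℕP.+-assoc m (b + p) b)
  m≡ : m ≡ m + 0
  m≡ = sym (ℕP.+-identityʳ m)
  join-arcs : (E + 0) + m ≡ n * m + (m + b) * (b + p) + (m + (b + p)) * b
  join-arcs = trans (cong (_+ m) (ℕP.+-identityʳ E)) (arcs-joinOf (part m (b + p) b) (threeClass-part m (b + p) b)
    (trans (classSize-part m (b + p) b 0) (first m (b + p) b))
    (trans (classSize-part m (b + p) b 1) (second m (b + p) b))
    (trans (classSize-part m (b + p) b 2) (third m (b + p) b)))
    where
    first : ∀ x y z → x * 1 + (y * 0 + z * 0) ≡ x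
    first = solve-∀
    second : ∀ x y z → x * 0 + (y * 1 + z * 0) ≡ y
    second = solve-∀
    third : ∀ x y z → x * 0 + (y * 0 + z * 1) ≡ z
    third = solve-∀
  tidy : ∀ W q r Y → 2 * W + 2 * 0 + q + 2 * 0 * r + Y ≡ 2 * W + (Y + q)
  tidy = solve-∀
  square : ∀ p → p ≤ 1 → p * p ≡ p
  square zero          _ = refl
  square (suc zero)    _ = refl
  square (suc (suc _)) (s≤s ())

harary-bound : ∀ {n m a b} p Y → 1 ≤ m → p ≤ 1 → n ≡ m + (a + b) → a ≡ b + p → m + 2 ≤ n →
  Y ≡ m * m + 2 * m + 2 * n + p → (G : Graph n) → V2AtMost G m →
  (harary G ≤ℚ ((ℤ.+ (3 * n * n + 2 * m * n)) -ℤ (ℤ.+ Y)) /ℚ 8)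
  × ((harary G ≡ ((ℤ.+ (3 * n * n + 2 * m * n)) -ℤ (ℤ.+ Y)) /ℚ 8) ⇔ (G ≅ KmJoinKab m a b))
harary-bound {m = suc M} {b = b} p _ (s≤s z≤n) p≤1 refl refl m+2≤n refl G v₂ =
  subst (harary G ≤ℚ_) (sym bound≡) (ℚP.≤-trans (harary-≤-weight G) (quarter-mono weight≤)) ,
  mk⇔ forward backward
  where
  m = suc M
  n = m + ((b + p) + b)
  K = KmJoinKab m (b + p) b
  Z = weight K
  open CoverBound G (v₂⇒cover v₂) m+2≤n using (slack; excess; no-slack)

  bound≡ : ((ℤ.+ (3 * n * n + 2 * m * n)) -ℤ (ℤ.+ (m * m + 2 * m + 2 * n + p))) /ℚ 8 ≡ quarter Z
  bound≡ = bound-quarter _ _ Z (extremal-weight m b p p≤1)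

  compare : 2 * weight G + slack ≡ 2 * Z + p
  compare = ℕP.+-cancelʳ-≡ (m * m + 2 * m + 2 * n) _ _ (trans excess (trans (extremal-weight m b p p≤1)
    (trans (cong (2 * Z +_) (ℕP.+-comm _ p)) (sym (ℕP.+-assoc (2 * Z) p _)))))

  weight≤ : weight G ≤ Z
  weight≤ = half-≤ compare p≤1

  -- equality in the Harary bound forces equal weights, hence slack p
  forward : harary G ≡ _ → G ≅ K
  forward H≡bound = no-slack (ℕP.+-cancelˡ-≡ (2 * Z) _ _ (subst (λ x → 2 * x + slack ≡ 2 * Z + p) weight≡ compare)) p≤1 refl
    where
    Z≤weight : Z ≤ weight G
    Z≤weight = quarter-cancel (subst (_≤ℚ quarter (weight G)) (trans H≡bound bound≡) (harary-≤-weight G))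
    weight≡ : weight G ≡ Z
    weight≡ = ℕP.≤-antisym weight≤ Z≤weight

  -- the image of the universal vertex of K makes G have diameter ≤ 2
  backward : G ≅ K → harary G ≡ _
  backward iso = trans (harary-≡-weight G 3≤n diameter) (trans (cong quarter (weight-≅ {G = G} {K} iso)) (sym bound≡))
    where
    3≤n : 3 ≤ n
    3≤n = ℕP.≤-trans (s≤s (ℕP.m≤n+m 2 M)) m+2≤n
    diameter : Diameter≤2 G
    diameter = universal⇒diameter≤2 G (universal-≅ {G = G} {K} iso (KmJoinKab-universal M (b + p) b))

even-halves : ∀ r → r % 2 ≡ 0 → r ≡ r / 2 + r / 2
even-halves r r-even = trans (m≡m%n+[m/n]*n r 2) (trans (cong (_+ r / 2 * 2) r-even) (twice (r / 2)))
  where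
  twice : ∀ k → 0 + k * 2 ≡ k + k
  twice = solve-∀

odd-halves : ∀ r → r % 2 ≡ 1 → ((r + 1) / 2 ≡ (r ∸ 1) / 2 + 1) × (r ≡ (r + 1) / 2 + (r ∸ 1) / 2)
odd-halves r r-odd = trans upper (cong (_+ 1) (sym lower)) ,
                     trans r≡ (trans (split k) (sym (cong₂ _+_ upper lower)))
  where
  k = r / 2
  r≡ : r ≡ 1 + k * 2
  r≡ = trans (m≡m%n+[m/n]*n r 2) (cong (_+ k * 2) r-odd)
  upper : (r + 1) / 2 ≡ k + 1
  upper = trans (cong (λ z → (z + 1) / 2) r≡) (trans (cong (_/ 2) (next k)) (m*n/n≡m (k + 1) 2))
    where
    next : ∀ k → 1 + k * 2 + 1 ≡ (k + 1) * 2
    next = solve-∀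
  lower : (r ∸ 1) / 2 ≡ k
  lower = trans (cong (λ z → (z ∸ 1) / 2) r≡) (m*n/n≡m k 2)
  split : ∀ k → 1 + k * 2 ≡ (k + 1) + k
  split = solve-∀

room : ∀ {n m} → 1 ≤ m → m ≤ n ∸ 2 → m + 2 ≤ n
room {zero}        (s≤s _) ()
room {suc zero}    (s≤s _) ()
room {suc (suc n)} {m} _ m≤n = subst (m + 2 ≤_) (ℕP.+-comm n 2) (ℕP.+-monoˡ-≤ 2 m≤n)

-- The embedding +_ : ℕ → ℤ is opened only here, where it no longer clashes
-- with sections such as `c +_`.
open import Data.Integer using (+_)

-- The theorem: the main lemma with the halves of n - m, p its parity.
corollary4p2 : (n m : ℕ) → 1 ≤ m → m ≤ n ∸ 2 →
    (G : Graph n) → Connected G → V2AtMost G m →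
    ((n ∸ m) % 2 ≡ 0 →
      (harary G ≤ℚ ((+ (3 * n * n + 2 * m * n)) -ℤ (+ (m * m + 2 * m + 2 * n))) /ℚ 8)
      × ((harary G ≡ ((+ (3 * n * n + 2 * m * n)) -ℤ (+ (m * m + 2 * m + 2 * n))) /ℚ 8)
          ⇔ (G ≅ KmJoinKab m ((n ∸ m) / 2) ((n ∸ m) / 2))))
    × ((n ∸ m) % 2 ≡ 1 →
      (harary G ≤ℚ ((+ (3 * n * n + 2 * m * n)) -ℤ (+ (m * m + 2 * m + 2 * n + 1))) /ℚ 8)
      × ((harary G ≡ ((+ (3 * n * n + 2 * m * n)) -ℤ (+ (m * m + 2 * m + 2 * n + 1))) /ℚ 8)
          ⇔ (G ≅ KmJoinKab m ((n ∸ m + 1) / 2) ((n ∸ m ∸ 1) / 2))))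
corollary4p2 n m 1≤m m≤n∸2 G _ v₂ = even , odd
  where
  m+2≤n : m + 2 ≤ n
  m+2≤n = room 1≤m m≤n∸2
  n≡m+r : n ≡ m + (n ∸ m)
  n≡m+r = sym (ℕP.m+[n∸m]≡n (ℕP.≤-trans (ℕP.m≤m+n m 2) m+2≤n))
  even : (n ∸ m) % 2 ≡ 0 → _
  even r-even = harary-bound 0 _ 1≤m z≤n (trans n≡m+r (cong (_+_ m) (even-halves (n ∸ m) r-even)))
    (sym (ℕP.+-identityʳ _)) m+2≤n (sym (ℕP.+-identityʳ _)) G v₂
  odd : (n ∸ m) % 2 ≡ 1 → _
  odd r-odd = harary-bound 1 _ 1≤m ℕP.≤-refl (trans n≡m+r (cong (_+_ m) (proj₂ halves))) (proj₁ halves)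
    m+2≤n refl G v₂
    where halves = odd-halves (n ∸ m) r-odd
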